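{- Let $P$ be a finite poset and let $Q$ be the split of $P$. Then $\operatorname{fdim}_2(P)\le\operatorname{fdim}_2(Q)$.
   Context: The split of $P$ is the two-level poset $Q$ with ground set $P'\cup P''$, where $P'=\{x':x\in P\}$ and $P''=\{x'':x\in P\}$ are disjoint copies of $P$, whose only strict relations are $x'<y''$ whenever $x\le y$ in $P$. A function $f$ from a poset $R$ to the $2$-element chain $\mathbf{2}$ is monotone if $x\le y$ implies $f(x)\le f(y)$. A fractional $2$-realiser of a finite poset $R$ is a function $w$ assigning a nonnegative weight to each monotone function $f:R\to\mathbf{2}$ such that for every pair $x,y\in R$ with $x\not\ge y$, $\sum\{w(f): f(x)<f(y)\}\ge1$. The fractional $2$-dimension $\operatorname{fdim}_2(R)$ is the minimum over all fractional $2$-realisers $w$ of the total weight $\sum_f w(f)$.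
   Formalization: The nonnegative weights of fractional $2$-realisers, and with them the values $\operatorname{fdim}_2(P)$ and $\operatorname{fdim}_2(Q)$, are rational. -}

module Defs where

open import Data.Nat using (ℕ; zero; suc; _+_)
open import Data.Fin using (Fin; _↑ˡ_; _↑ʳ_)
open import Data.Bool using (Bool; true; false; _≤_; if_then_else_; _∧_; not)
open import Data.Vec using (Vec; []; _∷_; lookup)
open import Data.List using (List; []; _∷_; map; _++_; foldr)
open import Data.Rational using (ℚ; 0ℚ; 1ℚ) renaming (_+_ to _+ℚ_; _≤_ to _≤ℚ_)
open import Data.Product using (Σ; _×_; ∃₂)
open import Data.Sum using (_⊎_)
open import Relation.Binary.PropositionalEquality using (_≡_)
open import Relation.Nullary using (¬_)

Rel : ℕ → Set₁
Rel n = Fin n → Fin n → Set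

-- A function Fin n → 2 is represented by a Bool vector (false < true in the
-- 2-element chain, Bool's _≤_).
Fun2 : ℕ → Set
Fun2 n = Vec Bool n

allFun2 : (n : ℕ) → List (Fun2 n)
allFun2 zero = [] ∷ []
allFun2 (suc n) = map (false ∷_) (allFun2 n) ++ map (true ∷_) (allFun2 n)

Monotone : {n : ℕ} → Rel n → Fun2 n → Set
Monotone {n} _≤R_ f = ∀ (x y : Fin n) → x ≤R y → lookup f x ≤ lookup f y

sumℚ : List ℚ → ℚ
sumℚ = foldr _+ℚ_ 0ℚ

-- Weighting of all functions R → 2; only monotone functions may carry nonzero weight
-- (equivalently: a weighting of the monotone functions).
Weight : ℕ → Set
Weight n = Fun2 n → ℚ

totalWeight : {n : ℕ} → Weight n → ℚ
totalWeight {n} w = sumℚ (map w (allFun2 n))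

-- Σ { w(f) : f(x) < f(y) }  (in 2, f(x) < f(y) iff f(x) = false and f(y) = true)
weightSeparating : {n : ℕ} → Weight n → Fin n → Fin n → ℚ
weightSeparating {n} w x y =
  sumℚ (map (λ f → if not (lookup f x) ∧ lookup f y then w f else 0ℚ) (allFun2 n))

record IsFractional2Realiser {n : ℕ} (_≤R_ : Rel n) (w : Weight n) : Set where
  field
    nonneg       : ∀ f → 0ℚ ≤ℚ w f
    onlyMonotone : ∀ f → ¬ (w f ≡ 0ℚ) → Monotone _≤R_ f
    separates    : ∀ (x y : Fin n) → ¬ (y ≤R x) → 1ℚ ≤ℚ weightSeparating w x y

IsFdim2 : {n : ℕ} → Rel n → ℚ → Set
IsFdim2 {n} _≤R_ t =
  Σ (Weight n) (λ w → IsFractional2Realiser _≤R_ w × totalWeight w ≡ t)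
  × (∀ (w : Weight n) → IsFractional2Realiser _≤R_ w → t ≤ℚ totalWeight w)

-- The split of P: ground set P' ∪ P'' ≅ Fin (n + n), with x' = x ↑ˡ n and
-- x'' = n ↑ʳ x; relations: equality, and x' ≤ y'' whenever x ≤ y in P.
Split : {n : ℕ} → Rel n → Rel (n + n)
Split {n} _≤P_ a b =
  a ≡ b ⊎ ∃₂ (λ x y → a ≡ (x ↑ˡ n) × b ≡ (n ↑ʳ y) × x ≤P y)

-- A fractional 2-realiser w of the split Q pushes forward to a fractional 2-realiser of P
-- of the same total weight along the map sending g : Q → 2 to
--   project g (x) = 1  iff  g(z') = 1 for some z ≤ x.
-- project g is monotone on P for every g. If g is monotone on Q with g(x'') = 0 and
-- g(y') = 1, then project g (y) = 1, while z ≤ x gives z' < x'' and hence g(z') = 0, so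
-- project g (x) = 0.
-- Since y ≰ x forces y' ≰ x'' in Q, every incomparable pair of P is separated at least as
-- heavily as the corresponding pair of Q, so fdim₂(P) is at most the total weight of w.
-- Defining project needs ≤P to be decidable; as the conclusion is a decidable inequality of
-- rationals, it suffices to have this under a double negation, which holds for any relation
-- on a finite set.
module Submission where

open import Defs
open import Data.Nat using (ℕ; zero; suc) renaming (_+_ to _+ℕ_)
open import Data.Fin using (Fin; _↑ˡ_; _↑ʳ_; splitAt) renaming (zero to fzero; suc to fsuc)
open import Data.Fin.Properties using (any?; splitAt-↑ˡ; splitAt-↑ʳ; ↑ˡ-injective; ↑ʳ-injective)
open import Data.Bool using (Bool; true; false; _∧_; not; if_then_else_) renaming (_≤_ to _≤ᵇ_)
import Data.Bool.Properties as Bool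
open import Data.Vec using ([]; _∷_; lookup; tabulate)
open import Data.Vec.Properties using (lookup∘tabulate; ≡-dec)
open import Data.List using (List; []; _∷_; map; _++_)
open import Data.List.Properties using (map-∘)
open import Data.Rational using (ℚ; _≤_; 0ℚ; 1ℚ; _+_; _≤?_; _≟_)
open import Data.Rational.Properties
  using (+-identityˡ; +-identityʳ; +-assoc; +-mono-≤; ≤-refl; ≤-trans; ≤-reflexive; +-0-commutativeMonoid; module ≤-Reasoning)
open import Data.Product using (∃; _×_; _,_)
open import Data.Sum using (inj₁; inj₂)
open import Data.Empty using (⊥-elim)
open import Function using (_∘_; _⇔_; mk⇔; Equivalence)
open import Algebra.Bundles using (CommutativeMonoid)
open import Algebra.Properties.CommutativeSemigroup (CommutativeMonoid.commutativeSemigroup +-0-commutativeMonoid)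
  using (interchange)
open import Relation.Nullary using (¬_; Dec; yes; no; does; _×-dec_)
open import Relation.Nullary.Decidable using (decidable-stable; dec-true; dec-false; ¬¬-excluded-middle)
open import Relation.Binary using (Decidable; Reflexive; Transitive; DecidableEquality)
open import Relation.Binary.PropositionalEquality using (_≡_; _≢_; refl; sym; trans; cong; cong₂; subst; subst₂; module ≡-Reasoning)
open import Relation.Binary.Structures using (IsPartialOrder)

sumOver : {A : Set} → List A → (A → ℚ) → ℚ
sumOver xs f = sumℚ (map f xs)

[_]·_ : Bool → ℚ → ℚ
[ b ]· q = if b then q else 0ℚ

private variable A B : Set

sumOver-cong : (xs : List A) {f g : A → ℚ} → (∀ a → f a ≡ g a) → sumOver xs f ≡ sumOver xs g
sumOver-cong []       f≡g = refl
sumOver-cong (a ∷ xs) f≡g = cong₂ _+_ (f≡g a) (sumOver-cong xs f≡g)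

sumOver-zero : (xs : List A) {f : A → ℚ} → (∀ a → f a ≡ 0ℚ) → sumOver xs f ≡ 0ℚ
sumOver-zero []       f≡0 = refl
sumOver-zero (a ∷ xs) f≡0 = trans (cong₂ _+_ (f≡0 a) (sumOver-zero xs f≡0)) (+-identityˡ 0ℚ)

sumOver-+ : (xs : List A) (f g : A → ℚ) → sumOver xs (λ a → f a + g a) ≡ sumOver xs f + sumOver xs g
sumOver-+ []       f g = sym (+-identityˡ 0ℚ)
sumOver-+ (a ∷ xs) f g =
  trans (cong (f a + g a +_) (sumOver-+ xs f g)) (interchange (f a) (g a) (sumOver xs f) (sumOver xs g))

sumOver-++ : (xs ys : List A) (f : A → ℚ) → sumOver (xs ++ ys) f ≡ sumOver xs f + sumOver ys f
sumOver-++ []       ys f = sym (+-identityˡ _)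
sumOver-++ (a ∷ xs) ys f = trans (cong (f a +_) (sumOver-++ xs ys f)) (sym (+-assoc (f a) _ _))

sumOver-mono : (xs : List A) {f g : A → ℚ} → (∀ a → f a ≤ g a) → sumOver xs f ≤ sumOver xs g
sumOver-mono []       f≤g = ≤-refl
sumOver-mono (a ∷ xs) f≤g = +-mono-≤ (f≤g a) (sumOver-mono xs f≤g)

sumOver-nonneg : (xs : List A) {f : A → ℚ} → (∀ a → 0ℚ ≤ f a) → 0ℚ ≤ sumOver xs f
sumOver-nonneg xs 0≤f = ≤-trans (≤-reflexive (sym (sumOver-zero xs (λ _ → refl)))) (sumOver-mono xs 0≤f)

sumOver-comm : (xs : List A) (ys : List B) (h : A → B → ℚ) →
               sumOver xs (λ a → sumOver ys (h a)) ≡ sumOver ys (λ b → sumOver xs (λ a → h a b))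
sumOver-comm []       ys h = sym (sumOver-zero ys (λ _ → refl))
sumOver-comm (a ∷ xs) ys h =
  trans (cong (sumOver ys (h a) +_) (sumOver-comm xs ys h))
        (sym (sumOver-+ ys (h a) (λ b → sumOver xs (λ a′ → h a′ b))))

sumOver-map : (xs : List B) (k : B → A) (f : A → ℚ) → sumOver (map k xs) f ≡ sumOver xs (f ∘ k)
sumOver-map xs k f = cong sumℚ (sym (map-∘ xs))

sumOver-[]· : (xs : List A) (c : Bool) (h : A → ℚ) → [ c ]· sumOver xs h ≡ sumOver xs (λ a → [ c ]· h a)
sumOver-[]· xs true  h = refl
sumOver-[]· xs false h = sym (sumOver-zero xs (λ _ → refl))

sumOver-[]·≢0⇒∃ : {P : A → Set} (P? : ∀ a → Dec (P a)) (xs : List A) (h : A → ℚ) →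
                  sumOver xs (λ a → [ does (P? a) ]· h a) ≢ 0ℚ → ∃ P
sumOver-[]·≢0⇒∃ P? []       h sum≢0 = ⊥-elim (sum≢0 refl)
sumOver-[]·≢0⇒∃ P? (a ∷ xs) h sum≢0 with P? a
... | yes Pa = a , Pa
... | no  _  = sumOver-[]·≢0⇒∃ P? xs h (sum≢0 ∘ trans (+-identityˡ _))

[]·-comm : (b c : Bool) (q : ℚ) → [ b ]· [ c ]· q ≡ [ c ]· [ b ]· q
[]·-comm true  true  q = refl
[]·-comm true  false q = refl
[]·-comm false true  q = refl
[]·-comm false false q = refl

[]·-mono : ∀ {b c q} → 0ℚ ≤ q → (q ≢ 0ℚ → b ≡ true → c ≡ true) → [ b ]· q ≤ [ c ]· q
[]·-mono {false} {false} 0≤q b⇒c = ≤-refl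
[]·-mono {false} {true}  0≤q b⇒c = 0≤q
[]·-mono {true}  {true}  0≤q b⇒c = ≤-refl
[]·-mono {true}  {false} {q} 0≤q b⇒c with q ≟ 0ℚ
... | yes refl = ≤-refl
... | no  q≢0  with () ← b⇒c q≢0 refl

_≟ᶠ_ : {n : ℕ} → DecidableEquality (Fun2 n)
_≟ᶠ_ = ≡-dec Bool._≟_

sumOver-allFun2-δ : (n : ℕ) (v : Fun2 n) (h : Fun2 n → ℚ) →
                    sumOver (allFun2 n) (λ f → [ does (v ≟ᶠ f) ]· h f) ≡ h v
sumOver-allFun2-δ zero    []      h = +-identityʳ (h [])
sumOver-allFun2-δ (suc n) (b ∷ v) h = begin
  sumOver (map (false ∷_) fs ++ map (true ∷_) fs) δh
    ≡⟨ sumOver-++ (map (false ∷_) fs) (map (true ∷_) fs) δh ⟩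
  sumOver (map (false ∷_) fs) δh + sumOver (map (true ∷_) fs) δh
    ≡⟨ cong₂ _+_ (sumOver-map fs (false ∷_) δh) (sumOver-map fs (true ∷_) δh) ⟩
  sumOver fs (δh ∘ (false ∷_)) + sumOver fs (δh ∘ (true ∷_))
    ≡⟨ split b ⟩
  h (b ∷ v) ∎
  where
  open ≡-Reasoning
  fs = allFun2 n
  δh : Fun2 (suc n) → ℚ
  δh f = [ does ((b ∷ v) ≟ᶠ f) ]· h f
  -- does ((b ∷ v) ≟ᶠ (c ∷ f)) computes to does (b ≟ c) ∧ does (v ≟ᶠ f).
  split : ∀ b → sumOver fs (λ f → [ does ((b ∷ v) ≟ᶠ (false ∷ f)) ]· h (false ∷ f))
              + sumOver fs (λ f → [ does ((b ∷ v) ≟ᶠ (true ∷ f)) ]· h (true ∷ f)) ≡ h (b ∷ v)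
  split false = trans (cong₂ _+_ (sumOver-allFun2-δ n v (h ∘ (false ∷_))) (sumOver-zero fs (λ _ → refl)))
                      (+-identityʳ _)
  split true  = trans (cong₂ _+_ (sumOver-zero fs (λ _ → refl)) (sumOver-allFun2-δ n v (h ∘ (true ∷_))))
                      (+-identityˡ _)

module _ {m n : ℕ} (F : Fun2 m → Fun2 n) where

  pushforward : Weight m → Weight n
  pushforward w f = sumOver (allFun2 m) (λ g → [ does (F g ≟ᶠ f) ]· w g)

  sumOver-pushforward : (w : Weight m) (c : Fun2 n → Bool) →
    sumOver (allFun2 n) (λ f → [ c f ]· pushforward w f) ≡ sumOver (allFun2 m) (λ g → [ c (F g) ]· w g)
  sumOver-pushforward w c = begin
    sumOver Fₙ (λ f → [ c f ]· sumOver Fₘ (λ g → [ δ g f ]· w g))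
      ≡⟨ sumOver-cong Fₙ (λ f → sumOver-[]· Fₘ (c f) _) ⟩
    sumOver Fₙ (λ f → sumOver Fₘ (λ g → [ c f ]· [ δ g f ]· w g))
      ≡⟨ sumOver-comm Fₙ Fₘ _ ⟩
    sumOver Fₘ (λ g → sumOver Fₙ (λ f → [ c f ]· [ δ g f ]· w g))
      ≡⟨ sumOver-cong Fₘ (λ g → sumOver-cong Fₙ (λ f → []·-comm (c f) (δ g f) (w g))) ⟩
    sumOver Fₘ (λ g → sumOver Fₙ (λ f → [ δ g f ]· [ c f ]· w g))
      ≡⟨ sumOver-cong Fₘ (λ g → sumOver-allFun2-δ n (F g) (λ f → [ c f ]· w g)) ⟩
    sumOver Fₘ (λ g → [ c (F g) ]· w g) ∎
    where
    open ≡-Reasoning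
    Fₘ = allFun2 m
    Fₙ = allFun2 n
    δ : Fun2 m → Fun2 n → Bool
    δ g f = does (F g ≟ᶠ f)

  totalWeight-pushforward : (w : Weight m) → totalWeight (pushforward w) ≡ totalWeight w
  totalWeight-pushforward w = sumOver-pushforward w (λ _ → true)

  weightSeparating-pushforward : (w : Weight m) (x y : Fin n) →
    weightSeparating (pushforward w) x y
      ≡ sumOver (allFun2 m) (λ g → [ not (lookup (F g) x) ∧ lookup (F g) y ]· w g)
  weightSeparating-pushforward w x y = sumOver-pushforward w (λ f → not (lookup f x) ∧ lookup f y)

  pushforward-nonneg : (w : Weight m) → (∀ g → 0ℚ ≤ w g) → ∀ f → 0ℚ ≤ pushforward w f
  pushforward-nonneg w 0≤w f = sumOver-nonneg (allFun2 m) (λ g → []·-mono (0≤w g) (λ _ ()))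

  pushforward-≢0⇒image : (w : Weight m) (f : Fun2 n) → pushforward w f ≢ 0ℚ → ∃ λ g → F g ≡ f
  pushforward-≢0⇒image w f = sumOver-[]·≢0⇒∃ (λ g → F g ≟ᶠ f) (allFun2 m) w

not∧≡true⇔ : ∀ {a b} → not a ∧ b ≡ true ⇔ (a ≡ false × b ≡ true)
not∧≡true⇔ {a} {b} = mk⇔ (to a b) (λ (a≡false , b≡true) → from a≡false b≡true)
  where
  to : ∀ a b → not a ∧ b ≡ true → a ≡ false × b ≡ true
  to false true _ = refl , refl
  from : ∀ {a b} → a ≡ false → b ≡ true → not a ∧ b ≡ true
  from refl refl = refl

Split⇒≤ : ∀ {n} {_≤P_ : Rel n} {x y} → Split _≤P_ (x ↑ˡ n) (n ↑ʳ y) → x ≤P y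
Split⇒≤ {n} {x = x} {y} (inj₁ x′≡y″)
  with () ← trans (sym (splitAt-↑ˡ n x n)) (trans (cong (splitAt n) x′≡y″) (splitAt-↑ʳ n n y))
Split⇒≤ {n} {_≤P_} {x} {y} (inj₂ (a , b , x′≡a′ , y″≡b″ , a≤b)) =
  subst₂ _≤P_ (sym (↑ˡ-injective n x a x′≡a′)) (sym (↑ʳ-injective n y b y″≡b″)) a≤b

module SplitProjection {n : ℕ} {_≤P_ : Rel n}
  (≤P-refl : Reflexive _≤P_) (≤P-trans : Transitive _≤P_) (_≤P?_ : Decidable _≤P_) where

  HitBelow : Fun2 (n +ℕ n) → Fin n → Set
  HitBelow g x = ∃ λ z → z ≤P x × lookup g (z ↑ˡ n) ≡ true

  hitBelow? : ∀ g x → Dec (HitBelow g x)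
  hitBelow? g x = any? (λ z → (z ≤P? x) ×-dec (lookup g (z ↑ˡ n) Bool.≟ true))

  project : Fun2 (n +ℕ n) → Fun2 n
  project g = tabulate (does ∘ hitBelow? g)

  lookup-project : ∀ g x → lookup (project g) x ≡ does (hitBelow? g x)
  lookup-project g = lookup∘tabulate (does ∘ hitBelow? g)

  project-monotone : ∀ g → Monotone _≤P_ (project g)
  project-monotone g x y x≤y rewrite lookup-project g x | lookup-project g y with hitBelow? g x
  ... | no  _                = Bool.≤-minimum _
  ... | yes (z , z≤x , g[z′]) = Bool.≤-reflexive (sym (dec-true (hitBelow? g y) (z , ≤P-trans z≤x x≤y , g[z′])))

  project-separates : ∀ g → Monotone (Split _≤P_) g → ∀ x y →
    lookup g (n ↑ʳ x) ≡ false → lookup g (y ↑ˡ n) ≡ true →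
    lookup (project g) x ≡ false × lookup (project g) y ≡ true
  project-separates g g-mono x y g[x″] g[y′] =
    trans (lookup-project g x) (dec-false (hitBelow? g x) no-hit) ,
    trans (lookup-project g y) (dec-true (hitBelow? g y) (y , ≤P-refl , g[y′]))
    where
    no-hit : ¬ HitBelow g x
    no-hit (z , z≤x , g[z′]) with () ← subst₂ _≤ᵇ_ g[z′] g[x″] (g-mono _ _ (inj₂ (z , x , refl , refl , z≤x)))

  project-realiser : ∀ {w} → IsFractional2Realiser (Split _≤P_) w →
                     IsFractional2Realiser _≤P_ (pushforward project w)
  project-realiser {w} R = record
    { nonneg       = pushforward-nonneg project w nonneg
    ; onlyMonotone = λ f w*f≢0 →
        let g , project[g]≡f = pushforward-≢0⇒image project w f w*f≢0
        in  subst (Monotone _≤P_) project[g]≡f (project-monotone g)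
    ; separates    = separates*
    }
    where
    open IsFractional2Realiser R
    open ≤-Reasoning
    separates* : ∀ x y → ¬ (y ≤P x) → 1ℚ ≤ weightSeparating (pushforward project w) x y
    separates* x y y≰x = begin
      1ℚ
        ≤⟨ separates (n ↑ʳ x) (y ↑ˡ n) (y≰x ∘ Split⇒≤) ⟩
      weightSeparating w (n ↑ʳ x) (y ↑ˡ n)
        ≤⟨ sumOver-mono (allFun2 (n +ℕ n)) (λ g → []·-mono (nonneg g) (separated g)) ⟩
      sumOver (allFun2 (n +ℕ n)) (λ g → [ not (lookup (project g) x) ∧ lookup (project g) y ]· w g)
        ≡⟨ sym (weightSeparating-pushforward project w x y) ⟩
      weightSeparating (pushforward project w) x y ∎
      where
      separated : ∀ g → w g ≢ 0ℚ → not (lookup g (n ↑ʳ x)) ∧ lookup g (y ↑ˡ n) ≡ true →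
                  not (lookup (project g) x) ∧ lookup (project g) y ≡ true
      separated g w[g]≢0 sep =
        let g[x″] , g[y′]     = Equivalence.to not∧≡true⇔ sep
            proj[x] , proj[y] = project-separates g (onlyMonotone g w[g]≢0) x y g[x″] g[y′]
        in  Equivalence.from not∧≡true⇔ (proj[x] , proj[y])

¬¬-∀-Fin : ∀ {n} {P : Fin n → Set} → (∀ i → ¬ ¬ P i) → ¬ ¬ (∀ i → P i)
¬¬-∀-Fin {zero}  ¬¬P ¬∀P = ¬∀P (λ ())
¬¬-∀-Fin {suc n} ¬¬P ¬∀P =
  ¬¬P fzero (λ P₀ → ¬¬-∀-Fin (¬¬P ∘ fsuc) (λ P₊ → ¬∀P λ { fzero → P₀ ; (fsuc i) → P₊ i }))

¬¬-decidable : ∀ {n} (R : Rel n) → ¬ ¬ Decidable R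
¬¬-decidable R = ¬¬-∀-Fin (λ x → ¬¬-∀-Fin (λ y → ¬¬-excluded-middle))

lemma13 : (n : ℕ) (_≤P_ : Fin n → Fin n → Set) → IsPartialOrder _≡_ _≤P_
    → (s t : ℚ) → IsFdim2 _≤P_ s → IsFdim2 (Split _≤P_) t → s ≤ t
lemma13 n _≤P_ isPartialOrder s t (_ , s-minimal) ((w , w-realiser , w-total) , _) =
  decidable-stable (s ≤? t) (λ s≰t → ¬¬-decidable _≤P_ (s≰t ∘ s≤t))
  where
  open IsPartialOrder isPartialOrder using () renaming (refl to ≤P-refl; trans to ≤P-trans)
  open ≤-Reasoning
  s≤t : Decidable _≤P_ → s ≤ t
  s≤t _≤P?_ = begin
    s                                   ≤⟨ s-minimal (pushforward project w) (project-realiser w-realiser) ⟩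
    totalWeight (pushforward project w) ≡⟨ totalWeight-pushforward project w ⟩
    totalWeight w                       ≡⟨ w-total ⟩
    t                                   ∎
    where open SplitProjection ≤P-refl ≤P-trans _≤P?_
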